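{- Let $n=p_1^{n_1}\cdots p_r^{n_r}$ with primes $p_1<\cdots<p_r$, positive integers $n_i$, and $r\ge 2$. For $a\in[r]$ and $s\in[n_a]$, $$|Z_a^s|=\phi(n)+\frac{n}{p_1\cdots p_r}\cdot\frac{1}{p_a^{s-1}}\cdot\left[\frac{p_1\cdots p_r}{p_a}+\phi\!\left(\frac{p_1\cdots p_r}{p_a}\right)\left(p_a^{s-1}-2\right)\right].$$
   Context: $\phi$ is Euler's totient function; $C_n$ is the cyclic group of order $n$; $[m]=\{1,\dots,m\}$. $E_d$ is the set of elements of $C_n$ of order $d$, $S_d$ the subgroup of order $d$. $Q_a^s$ is the union of the subgroups $S_{n/(p_ip_a^s)}$ over $i\in[r]\setminus\{a\}$, and $Z_a^s:=E_n\cup E_{n/p_a}\cup\cdots\cup E_{n/p_a^{s-1}}\cup Q_a^s$. -}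

module Defs where

open import Data.Nat using (ℕ; zero; suc; _*_; _^_; _<_; _≤_; _<?_; _≟_)
open import Data.Nat.Divisibility using (_∣_; _∣?_)
open import Data.Nat.GCD using (gcd)
open import Data.Fin using (Fin; toℕ; _≟_)
open import Data.Fin.Properties using (all?; any?)
open import Data.List using (List; length; filter; map; upTo; allFin)
open import Data.Product using (Σ; _×_; _,_)
open import Data.Sum using (_⊎_)
open import Relation.Nullary using (¬_; Dec)
open import Relation.Nullary.Decidable using (_×-dec_; _→-dec_; _⊎-dec_; ¬?)

-- Total natural-number division (m ÷ 0 := 0); only used with nonzero divisors.
_÷_ : ℕ → ℕ → ℕ
m ÷ zero  = 0
m ÷ suc k = Data.Nat._/_ m (suc k)

φ : ℕ → ℕ
φ m = length (filter (λ k → gcd k m Data.Nat.≟ 1) (map suc (upTo m)))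

-- The cyclic group C_n is modelled as ℤ/nℤ with carrier Fin n (addition mod n).
-- The k-th multiple of x is zero iff  n ∣ k * x.
kx≡0 : (n : ℕ) → ℕ → Fin n → Set
kx≡0 n k x = n ∣ k * toℕ x

HasOrder : (n : ℕ) → ℕ → Fin n → Set
HasOrder n d x = (0 < d) × kx≡0 n d x × ((j : Fin d) → 0 < toℕ j → ¬ kx≡0 n (toℕ j) x)

hasOrder? : (n d : ℕ) (x : Fin n) → Dec (HasOrder n d x)
hasOrder? n d x = (0 <? d) ×-dec (n ∣? d * toℕ x)
  ×-dec all? (λ j → (0 <? toℕ j) →-dec ¬? (n ∣? toℕ j * toℕ x))

E : (n d : ℕ) → Fin n → Set
E n d x = HasOrder n d x

S : (n d : ℕ) → Fin n → Set
S n d x = kx≡0 n d x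

-- Z_a^s for n = ∏ p_i^{e_i}, given the primes p : Fin r → ℕ, a : Fin r, s : ℕ :
--   E_n ∪ E_{n/p_a} ∪ … ∪ E_{n/p_a^{s-1}} ∪ Q_a^s,
--   Q_a^s = ⋃_{i ≠ a} S_{n/(p_i p_a^s)}.
Q : (n r : ℕ) (p : Fin r → ℕ) (a : Fin r) (s : ℕ) → Fin n → Set
Q n r p a s x = Σ (Fin r) λ i → ¬ (i ≡ a) × S n (n ÷ (p i * p a ^ s)) x
  where open import Relation.Binary.PropositionalEquality using (_≡_)

Z : (n r : ℕ) (p : Fin r → ℕ) (a : Fin r) (s : ℕ) → Fin n → Set
Z n r p a s x = (Σ (Fin s) λ j → E n (n ÷ (p a ^ toℕ j)) x) ⊎ Q n r p a s x

Z? : (n r : ℕ) (p : Fin r → ℕ) (a : Fin r) (s : ℕ) (x : Fin n) → Dec (Z n r p a s x)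
Z? n r p a s x =
  any? (λ j → hasOrder? n (n ÷ (p a ^ toℕ j)) x)
  ⊎-dec any? (λ i → ¬? (i Data.Fin.≟ a) ×-dec (n ∣? (n ÷ (p i * p a ^ s)) * toℕ x))

card-Z : (n r : ℕ) (p : Fin r → ℕ) (a : Fin r) (s : ℕ) → ℕ
card-Z n r p a s = length (filter (Z? n r p a s) (allFin n))

∏ : (r : ℕ) → (Fin r → ℕ) → ℕ
∏ zero    f = 1
∏ (suc r) f = f Fin.zero * ∏ r (λ i → f (Fin.suc i))
  where import Data.Fin as Fin

module Submission where

-- With m = ∏_{i≠a} p_i, the order of x is n/p_a^j (j < e_a) exactly when p_a^j is the
-- exact power of p_a dividing x and x is prime to m. Hence x ∈ Z_a^s iff either p_a^s ∣ x and x shares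
-- a prime with m (that is Q_a^s), or neither holds (that is E_n ∪ … ∪ E_{n/p_a^{s-1}}). Both conditions
-- are periodic modulo p_a^s m; in one period the first holds for m − φ(m) points (multiples of p_a^s,
-- which correspond to residues mod m) and the second for (p_a^s − 1) φ(m) points. The same count with
-- s = 1 gives φ(n) = (n/(p_a m)) (p_a − 1) φ(m), and the formula is then a ring identity.

open import Defs

module Counting where

  open import Data.Fin using (Fin; toℕ)
  import Data.Fin as Fin
  open import Data.List using (length; filter; tabulate; applyUpTo)
  open import Data.Nat
  open import Data.Nat.Properties
  open import Data.Nat.Divisibility
  open import Data.Product using (_,_; swap)
  open import Function using (_⇔_; mk⇔; id; Equivalence)
  open import Relation.Nullary using (Dec; yes; no; ¬_; contradiction)
  open import Relation.Nullary.Decidable using (_×-dec_; _⊎-dec_; ¬?)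
  open import Relation.Unary using (Decidable)
  open import Relation.Unary.Properties using (U?; _∩?_; ∁?; _∪?_)
  open import Relation.Binary.PropositionalEquality hiding ([_])
  open import Algebra.Properties.CommutativeSemigroup +-commutativeSemigroup using (interchange)

  [_] : {A : Set} → Dec A → ℕ
  [ yes _ ] = 1
  [ no  _ ] = 0

  count : {P : ℕ → Set} → Decidable P → ℕ → ℕ
  count P? zero    = 0
  count P? (suc m) = [ P? 0 ] + count (λ x → P? (suc x)) m

  ≡⇒⇔ : (P : ℕ → Set) {x y : ℕ} → x ≡ y → P x ⇔ P y
  ≡⇒⇔ P refl = mk⇔ id id

  []-cong : {A B : Set} → A ⇔ B → (a? : Dec A) (b? : Dec B) → [ a? ] ≡ [ b? ]
  []-cong _   (yes _) (yes _) = refl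
  []-cong _   (no _)  (no _)  = refl
  []-cong A⇔B (yes a) (no ¬b) = contradiction (Equivalence.to A⇔B a) ¬b
  []-cong A⇔B (no ¬a) (yes b) = contradiction (Equivalence.from A⇔B b) ¬a

  count-cong : ∀ m {P Q : ℕ → Set} (P? : Decidable P) (Q? : Decidable Q) →
               (∀ x → P x ⇔ Q x) → count P? m ≡ count Q? m
  count-cong zero    P? Q? P⇔Q = refl
  count-cong (suc m) P? Q? P⇔Q =
    cong₂ _+_ ([]-cong (P⇔Q 0) (P? 0) (Q? 0)) (count-cong m _ _ (λ x → P⇔Q (suc x)))

  count-+ : ∀ k l {P : ℕ → Set} (P? : Decidable P) →
            count P? (k + l) ≡ count P? k + count (λ x → P? (k + x)) l
  count-+ zero    l P? = refl
  count-+ (suc k) l P? =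
    trans (cong ([ P? 0 ] +_) (count-+ k l (λ x → P? (suc x)))) (sym (+-assoc [ P? 0 ] _ _))

  count-U : ∀ m → count U? m ≡ m
  count-U zero    = refl
  count-U (suc m) = cong suc (count-U m)

  count-none : ∀ m {P : ℕ → Set} (P? : Decidable P) → (∀ x → x < m → ¬ P x) → count P? m ≡ 0
  count-none zero    P? ¬P = refl
  count-none (suc m) P? ¬P with P? 0
  ... | yes P0 = contradiction P0 (¬P 0 z<s)
  ... | no  _  = count-none m (λ x → P? (suc x)) (λ x x<m → ¬P (suc x) (s<s x<m))

  count-∩-comm : ∀ m {P Q : ℕ → Set} (P? : Decidable P) (Q? : Decidable Q) →
                 count (P? ∩? Q?) m ≡ count (Q? ∩? P?) m
  count-∩-comm m P? Q? = count-cong m (P? ∩? Q?) (Q? ∩? P?) (λ _ → mk⇔ swap swap)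

  []-partition : {A B : Set} (a? : Dec A) (b? : Dec B) → [ a? ×-dec b? ] + [ ¬? a? ×-dec b? ] ≡ [ b? ]
  []-partition (yes _) (yes _) = refl
  []-partition (yes _) (no _)  = refl
  []-partition (no _)  (yes _) = refl
  []-partition (no _)  (no _)  = refl

  count-partition : ∀ m {P Q : ℕ → Set} (P? : Decidable P) (Q? : Decidable Q) →
                    count (P? ∩? Q?) m + count (∁? P? ∩? Q?) m ≡ count Q? m
  count-partition zero    P? Q? = refl
  count-partition (suc m) P? Q? =
    trans (interchange [ (P? ∩? Q?) 0 ] _ [ (∁? P? ∩? Q?) 0 ] _)
          (cong₂ _+_ ([]-partition (P? 0) (Q? 0))
                     (count-partition m (λ x → P? (suc x)) (λ x → Q? (suc x))))

  []-⊎ : {A B : Set} → (A → ¬ B) → (a? : Dec A) (b? : Dec B) → [ a? ⊎-dec b? ] ≡ [ a? ] + [ b? ]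
  []-⊎ disjoint (yes a) (yes b) = contradiction b (disjoint a)
  []-⊎ disjoint (yes _) (no _)  = refl
  []-⊎ disjoint (no _)  (yes _) = refl
  []-⊎ disjoint (no _)  (no _)  = refl

  count-∪ : ∀ m {P Q : ℕ → Set} (P? : Decidable P) (Q? : Decidable Q) → (∀ x → P x → ¬ Q x) →
            count (P? ∪? Q?) m ≡ count P? m + count Q? m
  count-∪ zero    P? Q? disjoint = refl
  count-∪ (suc m) P? Q? disjoint =
    trans (cong₂ _+_ ([]-⊎ (disjoint 0) (P? 0) (Q? 0))
                     (count-∪ m (λ x → P? (suc x)) (λ x → Q? (suc x)) (λ x → disjoint (suc x))))
          (interchange [ P? 0 ] [ Q? 0 ] _ _)

  count-periodic : ∀ M k {P : ℕ → Set} (P? : Decidable P) → (∀ x → P (M + x) ⇔ P x) →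
                   count P? (k * M) ≡ k * count P? M
  count-periodic M zero    P? periodic = refl
  count-periodic M (suc k) P? periodic = begin
    count P? (M + k * M)                                ≡⟨ count-+ M (k * M) P? ⟩
    count P? M + count (λ x → P? (M + x)) (k * M)        ≡⟨ cong (count P? M +_) (count-cong (k * M) _ P? periodic) ⟩
    count P? M + count P? (k * M)                        ≡⟨ cong (count P? M +_) (count-periodic M k P? periodic) ⟩
    count P? M + k * count P? M                          ∎
    where open ≡-Reasoning

  count-multiples : ∀ q k {P : ℕ → Set} (P? : Decidable P) → .{{NonZero q}} →
                    count (P? ∩? (q ∣?_)) (q * k) ≡ count (λ y → P? (q * y)) k
  count-multiples q zero P? rewrite *-zeroʳ q = refl
  count-multiples q@(suc q′) (suc k) {P} P? = begin
    count (P? ∩? (q ∣?_)) (q * suc k)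
      ≡⟨ cong (count (P? ∩? (q ∣?_))) (*-suc q k) ⟩
    count (P? ∩? (q ∣?_)) (q + q * k)
      ≡⟨ count-+ q (q * k) (P? ∩? (q ∣?_)) ⟩
    count (P? ∩? (q ∣?_)) q + count (λ x → P? (q + x) ×-dec q ∣? (q + x)) (q * k)
      ≡⟨ cong₂ _+_ first-period (count-cong (q * k) _ ((λ x → P? (q + x)) ∩? (q ∣?_))
                                   (λ x → mk⇔ (λ (Px , q∣q+x) → Px , ∣m+n∣m⇒∣n q∣q+x ∣-refl)
                                              (λ (Px , q∣x) → Px , ∣m∣n⇒∣m+n ∣-refl q∣x))) ⟩
    [ P? 0 ] + count ((λ x → P? (q + x)) ∩? (q ∣?_)) (q * k)
      ≡⟨ cong₂ _+_ ([]-cong (≡⇒⇔ P (sym (*-zeroʳ q))) (P? 0) (P? (q * 0)))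
                   (count-multiples q k (λ x → P? (q + x))) ⟩
    [ P? (q * 0) ] + count (λ y → P? (q + q * y)) k
      ≡⟨ cong ([ P? (q * 0) ] +_) (count-cong k _ _ (λ y → ≡⇒⇔ P (sym (*-suc q y)))) ⟩
    count (λ y → P? (q * y)) (suc k) ∎
    where
    open ≡-Reasoning
    first-period : count (P? ∩? (q ∣?_)) q ≡ [ P? 0 ]
    first-period = trans (cong₂ _+_
      ([]-cong (mk⇔ (λ (P0 , _) → P0) (λ P0 → P0 , q ∣0)) (P? 0 ×-dec q ∣? 0) (P? 0))
      (count-none q′ _ (λ x x<q′ (_ , q∣1+x) → <⇒≱ (s<s x<q′) (∣⇒≤ q∣1+x))))
      (+-identityʳ _)

  count-rotate : ∀ m {P : ℕ → Set} (P? : Decidable P) → (P 0 ⇔ P m) →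
                 count (λ x → P? (suc x)) m ≡ count P? m
  count-rotate m {P} P? P0⇔Pm = +-cancelˡ-≡ [ P? 0 ] _ _ (begin
    [ P? 0 ] + count (λ x → P? (suc x)) m    ≡⟨ cong (count P?) (+-comm 1 m) ⟩
    count P? (m + 1)                         ≡⟨ count-+ m 1 P? ⟩
    count P? m + ([ P? (m + 0) ] + 0)        ≡⟨ cong (count P? m +_) (+-identityʳ _) ⟩
    count P? m + [ P? (m + 0) ]              ≡⟨ +-comm (count P? m) _ ⟩
    [ P? (m + 0) ] + count P? m              ≡⟨ cong (_+ count P? m) ([]-cong P[m+0]⇔P0 (P? (m + 0)) (P? 0)) ⟩
    [ P? 0 ] + count P? m                    ∎)
    where
    open ≡-Reasoning
    P[m+0]⇔P0 : P (m + 0) ⇔ P 0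
    P[m+0]⇔P0 = mk⇔ (λ p → Equivalence.from P0⇔Pm (subst P (+-identityʳ m) p))
                    (λ p → subst P (sym (+-identityʳ m)) (Equivalence.to P0⇔Pm p))

  length-filter-applyUpTo : ∀ m {A : Set} {P : A → Set} (P? : Decidable P) (f : ℕ → A) →
                            length (filter P? (applyUpTo f m)) ≡ count (λ x → P? (f x)) m
  length-filter-applyUpTo zero    P? f = refl
  length-filter-applyUpTo (suc m) P? f with P? (f 0)
  ... | yes _ = cong suc (length-filter-applyUpTo m P? (λ x → f (suc x)))
  ... | no  _ = length-filter-applyUpTo m P? (λ x → f (suc x))

  length-filter-tabulate : ∀ n {A : Set} {P : A → Set} (P? : Decidable P) (g : Fin n → A)
                           {Q : ℕ → Set} (Q? : Decidable Q) → (∀ i → P (g i) ⇔ Q (toℕ i)) →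
                           length (filter P? (tabulate g)) ≡ count Q? n
  length-filter-tabulate zero    P? g Q? P⇔Q = refl
  length-filter-tabulate (suc n) P? g Q? P⇔Q with P? (g Fin.zero) | Q? 0
  ... | yes _  | yes _  = cong suc rest
    where rest = length-filter-tabulate n P? (λ i → g (Fin.suc i)) (λ x → Q? (suc x)) (λ i → P⇔Q (Fin.suc i))
  ... | no  _  | no  _  = length-filter-tabulate n P? (λ i → g (Fin.suc i)) (λ x → Q? (suc x)) (λ i → P⇔Q (Fin.suc i))
  ... | yes p  | no ¬q  = contradiction (Equivalence.to (P⇔Q Fin.zero) p) ¬q
  ... | no ¬p  | yes q  = contradiction (Equivalence.from (P⇔Q Fin.zero) q) ¬p

module NumberTheory where

  open Counting
  open import Data.List using (length; filter; applyUpTo; []; _∷_)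
  open import Data.List.Properties using (map-upTo)
  open import Data.List.Relation.Unary.All using (_∷_)
  open import Data.Nat
  open import Data.Nat.Properties
  open import Data.Nat.Divisibility
  open import Data.Nat.DivMod using (m*n/n≡m; m/n*n≡m)
  open import Data.Nat.Primality using (Prime; euclidsLemma; prime⇒irreducible; prime⇒nonTrivial; prime⇒nonZero)
  open import Data.Nat.Primality.Factorisation using (factorise)
  open import Data.Nat.Coprimality using (Coprime; coprime-divisor; gcd≡1⇒coprime; coprime⇒gcd≡1)
    renaming (sym to sym-coprime)
  open import Data.Nat.GCD using (gcd; gcd[m,n]∣m; gcd-greatest; gcd-identityˡ)
  open import Data.Product using (∃-syntax; _×_; _,_)
  open import Data.Sum using (inj₁; inj₂)
  open import Function using (_∘_; _⇔_; mk⇔)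
  open import Relation.Nullary using (¬_; contradiction; yes; no)
  open import Relation.Binary.PropositionalEquality

  ∣c⇒[∣c+x⇔∣x] : ∀ {d c x} → d ∣ c → (d ∣ c + x) ⇔ (d ∣ x)
  ∣c⇒[∣c+x⇔∣x] d∣c = mk⇔ (λ d∣c+x → ∣m+n∣m⇒∣n d∣c+x d∣c) (∣m∣n⇒∣m+n d∣c)

  ^-mono-∣ : ∀ m {i k} → i ≤ k → m ^ i ∣ m ^ k
  ^-mono-∣ m {i} {k} i≤k =
    subst (m ^ i ∣_) (trans (sym (^-distribˡ-+-* m i (k ∸ i))) (cong (m ^_) (m+[n∸m]≡n i≤k))) (m∣m*n _)

  ∣^ : ∀ {q j} → 1 ≤ j → q ∣ q ^ j
  ∣^ {q} {suc j} _ = m∣m*n (q ^ j)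

  ∃exact-power : ∀ q y s → ¬ q ^ s ∣ y → ∃[ k ] k < s × q ^ k ∣ y × ¬ q ^ suc k ∣ y
  ∃exact-power q y zero    ¬1∣y = contradiction (1∣ y) ¬1∣y
  ∃exact-power q y (suc s) ¬q^1+s∣y with q ^ s ∣? y
  ... | yes q^s∣y = s , ≤-refl , q^s∣y , ¬q^1+s∣y
  ... | no ¬q^s∣y with ∃exact-power q y s ¬q^s∣y
  ...   | k , k<s , q^k∣y , ¬q^1+k∣y = k , m<n⇒m<1+n k<s , q^k∣y , ¬q^1+k∣y

  ÷-cancelʳ : ∀ k d → .{{NonZero d}} → (k * d) ÷ d ≡ k
  ÷-cancelʳ k (suc d) = m*n/n≡m k (suc d)

  ∣⇒≡÷* : ∀ {n d} → .{{NonZero d}} → d ∣ n → n ≡ (n ÷ d) * d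
  ∣⇒≡÷* {d = suc d} d∣n = sym (m/n*n≡m d∣n)

  prime>1 : ∀ {p} → Prime p → 1 < p
  prime>1 {p} p-prime = nonTrivial⇒n>1 p {{prime⇒nonTrivial p-prime}}

  prime≢1 : ∀ {p} → Prime p → p ≢ 1
  prime≢1 p-prime p≡1 = <⇒≢ (prime>1 p-prime) (sym p≡1)

  prime∣prime⇒≡ : ∀ {p q} → Prime p → Prime q → q ∣ p → q ≡ p
  prime∣prime⇒≡ p-prime q-prime q∣p with prime⇒irreducible p-prime q∣p
  ... | inj₁ q≡1 = contradiction q≡1 (prime≢1 q-prime)
  ... | inj₂ q≡p = q≡p

  prime∣^⇒∣ : ∀ {p q} → Prime q → ∀ k → q ∣ p ^ k → q ∣ p
  prime∣^⇒∣ q-prime zero    q∣1 = contradiction (∣1⇒≡1 q∣1) (prime≢1 q-prime)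
  prime∣^⇒∣ {p} q-prime (suc k) q∣p^1+k with euclidsLemma p (p ^ k) q-prime q∣p^1+k
  ... | inj₁ q∣p   = q∣p
  ... | inj₂ q∣p^k = prime∣^⇒∣ q-prime k q∣p^k

  ∃prime∣ : ∀ {d} → 1 < d → ∃[ q ] Prime q × q ∣ d
  ∃prime∣ {d} 1<d with factorise d {{>-nonZero (<-trans z<s 1<d)}}
  ... | record { factors = [] ; isFactorisation = d≡1 } = contradiction d≡1 (>⇒≢ 1<d)
  ... | record { factors = q ∷ _ ; isFactorisation = d≡q*_ ; factorsPrime = q-prime ∷ _ } =
    q , q-prime , subst (q ∣_) (sym d≡q*_) (m∣m*n _)

  NoCommonPrime : ℕ → ℕ → Set
  NoCommonPrime m k = ∀ {q} → Prime q → q ∣ m → ¬ q ∣ k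

  coprime-if-no-common-prime : ∀ {m k} → .{{NonZero m}} → NoCommonPrime m k → Coprime m k
  coprime-if-no-common-prime {m} no-common {zero}        (0∣m , _) = contradiction (0∣⇒≡0 0∣m) (≢-nonZero⁻¹ m)
  coprime-if-no-common-prime     no-common {suc zero}    _         = refl
  coprime-if-no-common-prime     no-common {suc (suc d)} (d∣m , d∣k) with ∃prime∣ {suc (suc d)} (s<s z<s)
  ... | q , q-prime , q∣d = contradiction (∣-trans q∣d d∣k) (no-common q-prime (∣-trans q∣d d∣m))

  coprime⇔no-common-prime : ∀ {m k} → .{{NonZero m}} → Coprime m k ⇔ NoCommonPrime m k
  coprime⇔no-common-prime = mk⇔
    (λ m⊥k {q} q-prime q∣m q∣k → prime≢1 q-prime (m⊥k (q∣m , q∣k)))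
    coprime-if-no-common-prime

  coprime⇒*∣ : ∀ {u v x} → Coprime u v → u ∣ x → v ∣ x → u * v ∣ x
  coprime⇒*∣ {u} {v} coprime u∣x (divides t x≡t*v) = subst (u * v ∣_) (sym x≡t*v)
    (*-monoˡ-∣ v (coprime-divisor coprime (subst (u ∣_) (trans x≡t*v (*-comm t v)) u∣x)))

  distinct-primes⇒coprime^ : ∀ {p q} → Prime p → Prime q → p ≢ q → ∀ k → Coprime p (q ^ k)
  distinct-primes⇒coprime^ p-prime q-prime p≢q k =
    coprime-if-no-common-prime {{prime⇒nonZero p-prime}} λ t-prime t∣p t∣q^k →
      p≢q (trans (sym (prime∣prime⇒≡ p-prime t-prime t∣p))
                 (prime∣prime⇒≡ q-prime t-prime (prime∣^⇒∣ t-prime k t∣q^k)))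

  gcd≡1⇔coprime : ∀ {x k} → gcd x k ≡ 1 ⇔ Coprime k x
  gcd≡1⇔coprime {x} {k} = mk⇔ to from
    where
    to : gcd x k ≡ 1 → Coprime k x
    to gcd≡1 = sym-coprime (gcd≡1⇒coprime gcd≡1)
    from : Coprime k x → gcd x k ≡ 1
    from k⊥x = coprime⇒gcd≡1 (sym-coprime k⊥x)

  gcd-idem : ∀ k → gcd k k ≡ k
  gcd-idem k = ∣-antisym (gcd[m,n]∣m k k) (gcd-greatest ∣-refl ∣-refl)

  φ≡count : ∀ k → φ k ≡ count (λ x → gcd x k ≟ 1) k
  φ≡count k = begin
    φ k                                                       ≡⟨ cong (length ∘ filter _) (map-upTo suc k) ⟩
    length (filter (λ x → gcd x k ≟ 1) (applyUpTo suc k))      ≡⟨ length-filter-applyUpTo k _ suc ⟩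
    count (λ x → gcd (suc x) k ≟ 1) k                          ≡⟨ count-rotate k (λ x → gcd x k ≟ 1)
                                                                    (≡⇒⇔ (_≡ 1) (trans (gcd-identityˡ k) (sym (gcd-idem k)))) ⟩
    count (λ x → gcd x k ≟ 1) k                                ∎
    where open ≡-Reasoning

module FiniteProducts where

  open NumberTheory using (prime≢1)
  open import Data.Fin using (Fin; zero; suc)
  open import Data.Fin.Properties using (suc-injective)
  open import Data.Nat hiding (zero; suc)
  import Data.Nat as ℕ
  open import Data.Nat.Properties hiding (suc-injective)
  open import Data.Nat.Divisibility
  open import Data.Nat.Primality using (Prime; euclidsLemma)
  open import Data.Product using (∃-syntax; _×_; _,_)
  open import Data.Sum using (inj₁; inj₂)
  open import Relation.Nullary using (contradiction)
  open import Relation.Binary.PropositionalEquality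
  open import Algebra.Properties.CommutativeSemigroup *-commutativeSemigroup using (x∙yz≈y∙xz)

  ∏-except : ∀ {r} → Fin r → (Fin r → ℕ) → ℕ
  ∏-except {ℕ.suc r} zero    f = ∏ r (λ i → f (suc i))
  ∏-except {ℕ.suc r} (suc a) f = f zero * ∏-except a (λ i → f (suc i))

  ∏≡*∏-except : ∀ {r} (a : Fin r) f → ∏ r f ≡ f a * ∏-except a f
  ∏≡*∏-except zero    f = refl
  ∏≡*∏-except (suc a) f =
    trans (cong (f zero *_) (∏≡*∏-except a (λ i → f (suc i)))) (x∙yz≈y∙xz (f zero) (f (suc a)) _)

  ∏-nonZero : ∀ r (f : Fin r → ℕ) → (∀ i → NonZero (f i)) → NonZero (∏ r f)
  ∏-nonZero ℕ.zero    f f≢0 = _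
  ∏-nonZero (ℕ.suc r) f f≢0 = m*n≢0 _ _ {{f≢0 zero}} {{∏-nonZero r (λ i → f (suc i)) (λ i → f≢0 (suc i))}}

  ∏-mono-∣ : ∀ r {f g : Fin r → ℕ} → (∀ i → f i ∣ g i) → ∏ r f ∣ ∏ r g
  ∏-mono-∣ ℕ.zero    f∣g = ∣-refl
  ∏-mono-∣ (ℕ.suc r) f∣g = *-pres-∣ (f∣g zero) (∏-mono-∣ r (λ i → f∣g (suc i)))

  ∏-except-mono-∣ : ∀ {r} (a : Fin r) {f g : Fin r → ℕ} → (∀ i → f i ∣ g i) → ∏-except a f ∣ ∏-except a g
  ∏-except-mono-∣ {ℕ.suc r} zero    f∣g = ∏-mono-∣ r (λ i → f∣g (suc i))
  ∏-except-mono-∣           (suc a) f∣g = *-pres-∣ (f∣g zero) (∏-except-mono-∣ a (λ i → f∣g (suc i)))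

  ∣∏ : ∀ r (f : Fin r → ℕ) i → f i ∣ ∏ r f
  ∣∏ r f i = subst (f i ∣_) (sym (∏≡*∏-except i f)) (m∣m*n _)

  ∣∏-except : ∀ {r} (a : Fin r) (f : Fin r → ℕ) {i} → i ≢ a → f i ∣ ∏-except a f
  ∣∏-except {ℕ.suc r} zero    f {zero}  i≢a = contradiction refl i≢a
  ∣∏-except {ℕ.suc r} zero    f {suc i} i≢a = ∣∏ r (λ i → f (suc i)) i
  ∣∏-except           (suc a) f {zero}  i≢a = m∣m*n _
  ∣∏-except           (suc a) f {suc i} i≢a =
    ∣n⇒∣m*n (f zero) (∣∏-except a (λ i → f (suc i)) (λ i≡a → i≢a (cong suc i≡a)))

  prime∣∏⇒∣ : ∀ {q} → Prime q → ∀ r (f : Fin r → ℕ) → q ∣ ∏ r f → ∃[ i ] q ∣ f i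
  prime∣∏⇒∣ q-prime ℕ.zero    f q∣1 = contradiction (∣1⇒≡1 q∣1) (prime≢1 q-prime)
  prime∣∏⇒∣ q-prime (ℕ.suc r) f q∣∏ with euclidsLemma (f zero) _ q-prime q∣∏
  ... | inj₁ q∣f0 = zero , q∣f0
  ... | inj₂ q∣∏′ with prime∣∏⇒∣ q-prime r (λ i → f (suc i)) q∣∏′
  ...   | i , q∣fi = suc i , q∣fi

  prime∣∏-except⇒∣ : ∀ {q} → Prime q → ∀ {r} (a : Fin r) (f : Fin r → ℕ) →
                     q ∣ ∏-except a f → ∃[ i ] i ≢ a × q ∣ f i
  prime∣∏-except⇒∣ q-prime {ℕ.suc r} zero f q∣∏ with prime∣∏⇒∣ q-prime r (λ i → f (suc i)) q∣∏
  ... | i , q∣fi = suc i , (λ ()) , q∣fi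
  prime∣∏-except⇒∣ q-prime (suc a) f q∣∏ with euclidsLemma (f zero) _ q-prime q∣∏
  ... | inj₁ q∣f0 = zero , (λ ()) , q∣f0
  ... | inj₂ q∣∏′ with prime∣∏-except⇒∣ q-prime a (λ i → f (suc i)) q∣∏′
  ...   | i , i≢a , q∣fi = suc i , (λ 1+i≡1+a → i≢a (suc-injective 1+i≡1+a)) , q∣fi

module CyclicOrder where

  open import Data.Fin using (Fin; toℕ; fromℕ<)
  open import Data.Fin.Properties using (toℕ<n; toℕ-fromℕ<)
  open import Data.List using (_∷_; [])
  open import Data.Nat
  open import Data.Nat.Properties
  open import Data.Nat.Divisibility
  open import Data.Nat.Coprimality using (Coprime; coprime-divisor)
  open import Data.Nat.Tactic.RingSolver using (solve)
  open import Data.Product using (_,_)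
  open import Function using (_⇔_; mk⇔)
  open import Relation.Nullary using (¬_)
  open import Relation.Binary.PropositionalEquality

  hasOrder⇒∣ : ∀ {n d m} {x : Fin n} → n ≡ d * m → HasOrder n d x → m ∣ toℕ x
  hasOrder⇒∣ {d = d} refl (0<d , dm∣dx , _) = *-cancelˡ-∣ d {{>-nonZero 0<d}} dm∣dx

  -- (d/q)·x is already 0, contradicting the minimality of d.
  hasOrder⇒¬∣ : ∀ {n d m q} {x : Fin n} → n ≡ d * m → HasOrder n d x → q ∣ d → 1 < q → ¬ q * m ∣ toℕ x
  hasOrder⇒¬∣ {n} {d} {m} {q} {x} n≡dm (0<d , _ , minimal) (divides t d≡tq) 1<q (divides c x≡cqm) =
    minimal (fromℕ< t<d) (subst (0 <_) (sym (toℕ-fromℕ< t<d)) 0<t)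
      (subst (λ k → n ∣ k * toℕ x) (sym (toℕ-fromℕ< t<d)) (divides c t*x≡c*n))
    where
    0<t : 0 < t
    0<t = n≢0⇒n>0 (λ t≡0 → <⇒≢ 0<d (sym (trans d≡tq (cong (_* q) t≡0))))
    t<d : t < d
    t<d = subst (t <_) (sym d≡tq) (m<m*n t q {{>-nonZero 0<t}} 1<q)
    t*x≡c*n : t * toℕ x ≡ c * n
    t*x≡c*n = begin
      t * toℕ x        ≡⟨ cong (t *_) x≡cqm ⟩
      t * (c * (q * m)) ≡⟨ solve (t ∷ c ∷ q ∷ m ∷ []) ⟩
      c * ((t * q) * m) ≡⟨ cong (λ k → c * (k * m)) (sym d≡tq) ⟩
      c * (d * m)       ≡⟨ cong (c *_) (sym n≡dm) ⟩
      c * n             ∎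
      where open ≡-Reasoning

  hasOrder-intro : ∀ {n d m c} {x : Fin n} → .{{NonZero d}} → .{{NonZero m}} →
                   n ≡ d * m → toℕ x ≡ c * m → Coprime d c → HasOrder n d x
  hasOrder-intro {d = d} {m} {c} {x} refl x≡cm d⊥c = >-nonZero⁻¹ d , dm∣dx , minimal
    where
    dm∣dx : d * m ∣ d * toℕ x
    dm∣dx = *-monoʳ-∣ d (subst (m ∣_) (sym x≡cm) (n∣m*n c))
    minimal : (j : Fin d) → 0 < toℕ j → ¬ d * m ∣ toℕ j * toℕ x
    minimal j 0<j dm∣jx = <⇒≱ (toℕ<n j) (∣⇒≤ {{>-nonZero 0<j}} d∣j)
      where
      d∣j : d ∣ toℕ j
      d∣j = coprime-divisor d⊥c (subst (d ∣_) (*-comm (toℕ j) c)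
              (*-cancelʳ-∣ m (subst (d * m ∣_) (trans (cong (toℕ j *_) x≡cm) (sym (*-assoc (toℕ j) c m))) dm∣jx)))

  kx≡0⇔∣ : ∀ {n} k {v} {x : Fin n} → .{{NonZero n}} → n ≡ k * v → kx≡0 n k x ⇔ v ∣ toℕ x
  kx≡0⇔∣ k refl = mk⇔ (*-cancelˡ-∣ k {{m*n≢0⇒m≢0 k}}) (*-monoʳ-∣ k)

module IntegerArithmetic where

  open import Data.Nat as ℕ using (ℕ)
  open import Data.Integer using (+_; _+_; _-_; _*_)
  open import Data.Integer.Properties using (pos-+; pos-*)
  open import Data.Integer.Tactic.RingSolver using (solve-∀)
  open import Relation.Binary.PropositionalEquality

  +-≡⇒≡- : ∀ {a b c : ℕ} → a ℕ.+ b ≡ c → + a ≡ + c - + b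
  +-≡⇒≡- {a} {b} refl = trans (cancel (+ a) (+ b)) (cong (_- + b) (sym (pos-+ a b)))
    where
    cancel : ∀ x y → x ≡ x + y - y
    cancel = solve-∀

  pos-*³ : ∀ x y z → + (x ℕ.* y ℕ.* z) ≡ + x * + y * + z
  pos-*³ x y z = trans (pos-* (x ℕ.* y) z) (cong (_* + z) (pos-* x y))

  card-identityℤ : ∀ R c q f P {Xₛ Y X₁} → Xₛ ≡ q * c * f - f → Y ≡ P - f → X₁ ≡ q * + 1 * f - f →
                   R * Xₛ + R * Y ≡ R * c * X₁ + R * (P + f * (c - + 2))
  card-identityℤ R c q f P refl refl refl = regroup R c q f P
    where
    regroup : ∀ R c q f P →
              R * (q * c * f - f) + R * (P - f) ≡ R * c * (q * + 1 * f - f) + R * (P + f * (c - + 2))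
    regroup = solve-∀

  card-identity : ∀ {R c q f P Y Xₛ X₁ : ℕ} →
    Xₛ ℕ.+ f ≡ q ℕ.* c ℕ.* f → Y ℕ.+ f ≡ P → X₁ ℕ.+ f ≡ q ℕ.* 1 ℕ.* f →
    + (R ℕ.* Xₛ ℕ.+ R ℕ.* Y) ≡ + (R ℕ.* c ℕ.* X₁) + + R * (+ P + + f * (+ c - + 2))
  card-identity {R} {c} {q} {f} {P} {Y} {Xₛ} {X₁} Xₛ+f≡ Y+f≡ X₁+f≡ = begin
    + (R ℕ.* Xₛ ℕ.+ R ℕ.* Y)
      ≡⟨ trans (pos-+ (R ℕ.* Xₛ) _) (cong₂ _+_ (pos-* R Xₛ) (pos-* R Y)) ⟩
    + R * + Xₛ + + R * + Y
      ≡⟨ card-identityℤ (+ R) (+ c) (+ q) (+ f) (+ P)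
           (trans (+-≡⇒≡- Xₛ+f≡) (cong (_- + f) (pos-*³ q c f)))
           (+-≡⇒≡- Y+f≡)
           (trans (+-≡⇒≡- X₁+f≡) (cong (_- + f) (pos-*³ q 1 f))) ⟩
    + R * + c * + X₁ + + R * (+ P + + f * (+ c - + 2))
      ≡⟨ cong (_+ + R * (+ P + + f * (+ c - + 2))) (sym (pos-*³ R c X₁)) ⟩
    + (R ℕ.* c ℕ.* X₁) + + R * (+ P + + f * (+ c - + 2)) ∎
    where open ≡-Reasoning

open import Data.Fin using (Fin; toℕ)
open import Data.Nat using (ℕ; _≤_; _<_; _^_; _*_; _∸_)
open import Data.Nat.Primality using (Prime)
open import Relation.Binary.PropositionalEquality using (_≡_)

module Factored (r : ℕ) (p e : Fin r → ℕ) (p-prime : ∀ i → Prime (p i))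
                (p-injective : ∀ {i j} → p i ≡ p j → i ≡ j) (e≥1 : ∀ i → 1 ≤ e i) (a : Fin r) where

  open Counting
  open NumberTheory
  open FiniteProducts
  open CyclicOrder
  import Data.Fin as Fin
  open import Data.Fin using (fromℕ<)
  open import Data.Fin.Properties using (any?; toℕ<n; toℕ-fromℕ<)
  open import Data.Nat hiding (_≟_)
  open import Data.Nat.Properties hiding (_≟_)
  open import Data.Nat.Divisibility
  open import Data.Nat.Primality using (prime⇒nonZero)
  open import Data.Nat.Coprimality using (Coprime; coprime-divisor)
  open import Data.Nat.Tactic.RingSolver using (solve-∀)
  open import Data.Product using (Σ; ∃-syntax; _×_; _,_; proj₂)
  open import Data.Product.Function.NonDependent.Propositional using (_×-⇔_)
  open import Data.Sum using (_⊎_)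
  open import Data.Sum.Function.Propositional using (_⊎-⇔_)
  open import Data.Unit using (tt)
  open import Function using (_⇔_; mk⇔; Equivalence; id)
  open import Function.Properties.Equivalence using () renaming (refl to ⇔-refl; trans to ⇔-trans)
  open import Function.Related.TypeIsomorphisms using (¬-cong-⇔)
  open import Relation.Nullary using (¬_; yes; no)
  open import Relation.Nullary.Decidable using (_×-dec_; ¬?)
  open import Relation.Unary using (Decidable)
  open import Relation.Unary.Properties using (U?; _∩?_; _∪?_; ∁?)
  open import Relation.Binary.PropositionalEquality
  open import Algebra.Properties.CommutativeSemigroup *-commutativeSemigroup using (xy∙z≈xz∙y)

  pₐ : ℕ
  pₐ = p a

  n m D : ℕ
  n = ∏ r (λ i → p i ^ e i)
  m = ∏-except a p
  D = ∏-except a (λ i → p i ^ e i)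

  instance
    p≢0 : ∀ {i} → NonZero (p i)
    p≢0 {i} = prime⇒nonZero (p-prime i)

    n≢0 : NonZero n
    n≢0 = ∏-nonZero r _ (λ i → m^n≢0 (p i) (e i))

    m≢0 : NonZero m
    m≢0 = m*n≢0⇒n≢0 pₐ {{subst NonZero (∏≡*∏-except a p) (∏-nonZero r p (λ _ → p≢0))}}

    D≢0 : NonZero D
    D≢0 = m*n≢0⇒n≢0 (pₐ ^ e a) {{subst NonZero (∏≡*∏-except a _) n≢0}}

  d : ℕ → ℕ
  d k = pₐ ^ (e a ∸ k) * D

  pₐ^≢0 : ∀ k → NonZero (pₐ ^ k)
  pₐ^≢0 k = m^n≢0 pₐ k

  d≢0 : ∀ k → NonZero (d k)
  d≢0 k = m*n≢0 (pₐ ^ (e a ∸ k)) D {{pₐ^≢0 (e a ∸ k)}}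

  n≡pₐ^eₐ*D : n ≡ pₐ ^ e a * D
  n≡pₐ^eₐ*D = ∏≡*∏-except a _

  p∣p^e : ∀ i → p i ∣ p i ^ e i
  p∣p^e i = ∣^ (e≥1 i)

  pᵢ∣n : ∀ i → p i ∣ n
  pᵢ∣n i = ∣-trans (p∣p^e i) (∣∏ r _ i)

  pₐ^∣n : ∀ {k} → k ≤ e a → pₐ ^ k ∣ n
  pₐ^∣n {k} k≤eₐ = subst (pₐ ^ k ∣_) (sym n≡pₐ^eₐ*D) (∣m⇒∣m*n D (^-mono-∣ pₐ k≤eₐ))

  pᵢ∣m : ∀ {i} → i ≢ a → p i ∣ m
  pᵢ∣m = ∣∏-except a p

  m∣D : m ∣ D
  m∣D = ∏-except-mono-∣ a p∣p^e

  pᵢ⊥pₐ^ : ∀ {i} → i ≢ a → ∀ k → Coprime (p i) (pₐ ^ k)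
  pᵢ⊥pₐ^ i≢a = distinct-primes⇒coprime^ (p-prime _) (p-prime a) (λ pᵢ≡pₐ → i≢a (p-injective pᵢ≡pₐ))

  prime∣n⇒≡p : ∀ {q} → Prime q → q ∣ n → ∃[ i ] q ≡ p i
  prime∣n⇒≡p q-prime q∣n with prime∣∏⇒∣ q-prime r _ q∣n
  ... | i , q∣p^e = i , prime∣prime⇒≡ (p-prime i) q-prime (prime∣^⇒∣ q-prime (e i) q∣p^e)

  OtherPrime∣ : ℕ → Set
  OtherPrime∣ x = Σ (Fin r) λ i → i ≢ a × p i ∣ x

  otherPrime∣? : Decidable OtherPrime∣
  otherPrime∣? x = any? (λ i → ¬? (i Fin.≟ a) ×-dec p i ∣? x)

  InE InQ : ℕ → ℕ → Set
  InE t x = ¬ OtherPrime∣ x × ¬ pₐ ^ t ∣ x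
  InQ t x = OtherPrime∣ x × pₐ ^ t ∣ x

  inE? : ∀ t → Decidable (InE t)
  inE? t = ∁? otherPrime∣? ∩? ∁? (pₐ ^ t ∣?_)

  inQ? : ∀ t → Decidable (InQ t)
  inQ? t = otherPrime∣? ∩? (pₐ ^ t ∣?_)

  otherPrime∣-+ : ∀ {c} → m ∣ c → ∀ x → OtherPrime∣ (c + x) ⇔ OtherPrime∣ x
  otherPrime∣-+ m∣c x = mk⇔
    (λ (i , i≢a , pᵢ∣c+x) → i , i≢a , Equivalence.to   (pᵢ∣c+x⇔pᵢ∣x i≢a) pᵢ∣c+x)
    (λ (i , i≢a , pᵢ∣x)   → i , i≢a , Equivalence.from (pᵢ∣c+x⇔pᵢ∣x i≢a) pᵢ∣x)
    where
    pᵢ∣c+x⇔pᵢ∣x : ∀ {i} → i ≢ a → p i ∣ _ + x ⇔ p i ∣ x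
    pᵢ∣c+x⇔pᵢ∣x i≢a = ∣c⇒[∣c+x⇔∣x] (∣-trans (pᵢ∣m i≢a) m∣c)

  otherPrime∣-pₐ^* : ∀ t y → OtherPrime∣ (pₐ ^ t * y) ⇔ OtherPrime∣ y
  otherPrime∣-pₐ^* t y = mk⇔ to (λ (i , i≢a , pᵢ∣y) → i , i≢a , ∣n⇒∣m*n (pₐ ^ t) pᵢ∣y)
    where
    to : OtherPrime∣ (pₐ ^ t * y) → OtherPrime∣ y
    to (i , i≢a , pᵢ∣pₐ^t*y) = i , i≢a , coprime-divisor (pᵢ⊥pₐ^ i≢a t) pᵢ∣pₐ^t*y

  noCommonPrime-m⇔¬otherPrime∣ : ∀ x → NoCommonPrime m x ⇔ (¬ OtherPrime∣ x)
  noCommonPrime-m⇔¬otherPrime∣ x = mk⇔ to from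
    where
    to : NoCommonPrime m x → ¬ OtherPrime∣ x
    to none (i , i≢a , pᵢ∣x) = none (p-prime i) (pᵢ∣m i≢a) pᵢ∣x
    from : ¬ OtherPrime∣ x → NoCommonPrime m x
    from ¬other q-prime q∣m q∣x with prime∣∏-except⇒∣ q-prime a p q∣m
    ... | i , i≢a , q∣pᵢ = ¬other (i , i≢a , subst (_∣ x) (prime∣prime⇒≡ (p-prime i) q-prime q∣pᵢ) q∣x)

  noCommonPrime-n⇔ : ∀ x → NoCommonPrime n x ⇔ (¬ OtherPrime∣ x × ¬ pₐ ∣ x)
  noCommonPrime-n⇔ x = mk⇔ to from
    where
    to : NoCommonPrime n x → ¬ OtherPrime∣ x × ¬ pₐ ∣ x
    to none = (λ (i , _ , pᵢ∣x) → none (p-prime i) (pᵢ∣n i) pᵢ∣x) , none (p-prime a) (pᵢ∣n a)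
    from : ¬ OtherPrime∣ x × ¬ pₐ ∣ x → NoCommonPrime n x
    from (¬other , pₐ∤x) q-prime q∣n q∣x with prime∣n⇒≡p q-prime q∣n
    ... | i , refl with i Fin.≟ a
    ...   | yes refl = pₐ∤x q∣x
    ...   | no i≢a   = ¬other (i , i≢a , q∣x)

  n≡d*pₐ^ : ∀ {k} → k ≤ e a → n ≡ d k * pₐ ^ k
  n≡d*pₐ^ {k} k≤eₐ = begin
    n                                   ≡⟨ n≡pₐ^eₐ*D ⟩
    pₐ ^ e a * D                        ≡⟨ cong (λ j → pₐ ^ j * D) (sym (m∸n+n≡m k≤eₐ)) ⟩
    pₐ ^ (e a ∸ k + k) * D              ≡⟨ cong (_* D) (^-distribˡ-+-* pₐ (e a ∸ k) k) ⟩
    pₐ ^ (e a ∸ k) * pₐ ^ k * D         ≡⟨ xy∙z≈xz∙y (pₐ ^ (e a ∸ k)) (pₐ ^ k) D ⟩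
    d k * pₐ ^ k                        ∎
    where open ≡-Reasoning

  n÷pₐ^≡d : ∀ {k} → k ≤ e a → n ÷ (pₐ ^ k) ≡ d k
  n÷pₐ^≡d {k} k≤eₐ = trans (cong (_÷ (pₐ ^ k)) (n≡d*pₐ^ k≤eₐ)) (÷-cancelʳ (d k) (pₐ ^ k) {{pₐ^≢0 k}})

  hasOrder⇔ : ∀ {k} → k < e a → (x : Fin n) →
              HasOrder n (d k) x ⇔ (pₐ ^ k ∣ toℕ x × ¬ pₐ ^ suc k ∣ toℕ x × ¬ OtherPrime∣ (toℕ x))
  hasOrder⇔ {k} k<eₐ x = mk⇔ to from
    where
    n≡ : n ≡ d k * pₐ ^ k
    n≡ = n≡d*pₐ^ (<⇒≤ k<eₐ)
    pₐ∣d : pₐ ∣ d k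
    pₐ∣d = ∣m⇒∣m*n D (∣^ (m<n⇒0<n∸m k<eₐ))
    pᵢ∣d : ∀ {i} → i ≢ a → p i ∣ d k
    pᵢ∣d i≢a = ∣n⇒∣m*n (pₐ ^ (e a ∸ k)) (∣-trans (pᵢ∣m i≢a) m∣D)
    to : HasOrder n (d k) x → pₐ ^ k ∣ toℕ x × ¬ pₐ ^ suc k ∣ toℕ x × ¬ OtherPrime∣ (toℕ x)
    to ord = pₐ^k∣x , hasOrder⇒¬∣ n≡ ord pₐ∣d (prime>1 (p-prime a)) , ¬other
      where
      pₐ^k∣x = hasOrder⇒∣ n≡ ord
      ¬other : ¬ OtherPrime∣ (toℕ x)
      ¬other (i , i≢a , pᵢ∣x) =
        hasOrder⇒¬∣ n≡ ord (pᵢ∣d i≢a) (prime>1 (p-prime i)) (coprime⇒*∣ (pᵢ⊥pₐ^ i≢a k) pᵢ∣x pₐ^k∣x)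
    from : pₐ ^ k ∣ toℕ x × ¬ pₐ ^ suc k ∣ toℕ x × ¬ OtherPrime∣ (toℕ x) → HasOrder n (d k) x
    from (divides c x≡c*pₐ^k , pₐ^1+k∤x , ¬other) =
      hasOrder-intro {{d≢0 k}} {{pₐ^≢0 k}} n≡ x≡c*pₐ^k (coprime-if-no-common-prime {{d≢0 k}} no-common)
      where
      d∣n : d k ∣ n
      d∣n = divides (pₐ ^ k) (trans n≡ (*-comm (d k) (pₐ ^ k)))
      no-common : NoCommonPrime (d k) c
      no-common q-prime q∣d q∣c with prime∣n⇒≡p q-prime (∣-trans q∣d d∣n)
      ... | i , refl with i Fin.≟ a
      ...   | yes refl = pₐ^1+k∤x (subst (pₐ ^ suc k ∣_) (sym x≡c*pₐ^k) (*-monoˡ-∣ (pₐ ^ k) q∣c))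
      ...   | no i≢a   = ¬other (i , i≢a , subst (p i ∣_) (sym x≡c*pₐ^k) (∣m⇒∣m*n (pₐ ^ k) q∣c))

  orderBelow⇔ : ∀ {s} → s ≤ e a → (x : Fin n) →
                (Σ (Fin s) λ j → E n (n ÷ (pₐ ^ toℕ j)) x) ⇔ InE s (toℕ x)
  orderBelow⇔ {s} s≤eₐ x = mk⇔ to from
    where
    to : (Σ (Fin s) λ j → E n (n ÷ (pₐ ^ toℕ j)) x) → InE s (toℕ x)
    to (j , ord) with Equivalence.to (hasOrder⇔ k<eₐ x) (subst (λ o → HasOrder n o x) (n÷pₐ^≡d (<⇒≤ k<eₐ)) ord)
      where k<eₐ = <-≤-trans (toℕ<n j) s≤eₐ
    ... | _ , pₐ^1+k∤x , ¬other = ¬other , λ pₐ^s∣x → pₐ^1+k∤x (∣-trans (^-mono-∣ pₐ (toℕ<n j)) pₐ^s∣x)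
    from : InE s (toℕ x) → Σ (Fin s) λ j → E n (n ÷ (pₐ ^ toℕ j)) x
    from (¬other , pₐ^s∤x) with ∃exact-power pₐ (toℕ x) s pₐ^s∤x
    ... | k , k<s , pₐ^k∣x , pₐ^1+k∤x = fromℕ< k<s , subst (λ o → HasOrder n o x) n÷≡d
        (Equivalence.from (hasOrder⇔ k<eₐ x) (pₐ^k∣x , pₐ^1+k∤x , ¬other))
      where
      k<eₐ = <-≤-trans k<s s≤eₐ
      n÷≡d : d k ≡ n ÷ (pₐ ^ toℕ (fromℕ< k<s))
      n÷≡d = sym (trans (cong (λ j → n ÷ (pₐ ^ j)) (toℕ-fromℕ< k<s)) (n÷pₐ^≡d (<⇒≤ k<eₐ)))

  Q⇔ : ∀ {s} → s ≤ e a → (x : Fin n) → Q n r p a s x ⇔ InQ s (toℕ x)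
  Q⇔ {s} s≤eₐ x = mk⇔
    (λ (i , i≢a , x∈S) → let (pᵢ∣x , pₐ^s∣x) = Equivalence.to (S⇔ i≢a) x∈S in (i , i≢a , pᵢ∣x) , pₐ^s∣x)
    (λ ((i , i≢a , pᵢ∣x) , pₐ^s∣x) → i , i≢a , Equivalence.from (S⇔ i≢a) (pᵢ∣x , pₐ^s∣x))
    where
    S⇔ : ∀ {i} → i ≢ a → S n (n ÷ (p i * pₐ ^ s)) x ⇔ (p i ∣ toℕ x × pₐ ^ s ∣ toℕ x)
    S⇔ {i} i≢a = mk⇔
      (λ x∈S → let v∣x = Equivalence.to x∈S⇔v∣x x∈S in m*n∣⇒m∣ (p i) _ v∣x , m*n∣⇒n∣ (p i) _ v∣x)
      (λ (pᵢ∣x , pₐ^s∣x) → Equivalence.from x∈S⇔v∣x (coprime⇒*∣ (pᵢ⊥pₐ^ i≢a s) pᵢ∣x pₐ^s∣x))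
      where
      instance
        v≢0 : NonZero (p i * pₐ ^ s)
        v≢0 = m*n≢0 (p i) (pₐ ^ s) {{p≢0}} {{pₐ^≢0 s}}
      x∈S⇔v∣x : S n (n ÷ (p i * pₐ ^ s)) x ⇔ p i * pₐ ^ s ∣ toℕ x
      x∈S⇔v∣x = kx≡0⇔∣ (n ÷ (p i * pₐ ^ s)) (∣⇒≡÷* (coprime⇒*∣ (pᵢ⊥pₐ^ i≢a s) (pᵢ∣n i) (pₐ^∣n s≤eₐ)))

  Z⇔InE⊎InQ : ∀ {s} → s ≤ e a → (x : Fin n) → Z n r p a s x ⇔ (InE s (toℕ x) ⊎ InQ s (toℕ x))
  Z⇔InE⊎InQ s≤eₐ x = orderBelow⇔ s≤eₐ x ⊎-⇔ Q⇔ s≤eₐ x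

  M : ℕ → ℕ
  M t = pₐ ^ t * m

  X Y : ℕ → ℕ
  X t = count (inE? t) (M t)
  Y t = count (inQ? t) (M t)

  otherPrime∣-periodic : ∀ t x → OtherPrime∣ (M t + x) ⇔ OtherPrime∣ x
  otherPrime∣-periodic t = otherPrime∣-+ (n∣m*n (pₐ ^ t))

  pₐ^∣-periodic : ∀ t x → pₐ ^ t ∣ M t + x ⇔ pₐ ^ t ∣ x
  pₐ^∣-periodic t x = ∣c⇒[∣c+x⇔∣x] (m∣m*n m)

  count-X : ∀ t k → count (inE? t) (k * M t) ≡ k * X t
  count-X t k = count-periodic (M t) k (inE? t)
    (λ x → ¬-cong-⇔ (otherPrime∣-periodic t x) ×-⇔ ¬-cong-⇔ (pₐ^∣-periodic t x))

  count-Y : ∀ t k → count (inQ? t) (k * M t) ≡ k * Y t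
  count-Y t k = count-periodic (M t) k (inQ? t) (λ x → otherPrime∣-periodic t x ×-⇔ pₐ^∣-periodic t x)

  φm≡count : φ m ≡ count (∁? otherPrime∣?) m
  φm≡count = trans (φ≡count m) (count-cong m _ _ λ x →
    ⇔-trans gcd≡1⇔coprime (⇔-trans coprime⇔no-common-prime (noCommonPrime-m⇔¬otherPrime∣ x)))

  φn≡count : φ n ≡ count (inE? 1) n
  φn≡count = trans (φ≡count n) (count-cong n _ _ λ x →
    ⇔-trans gcd≡1⇔coprime (⇔-trans coprime⇔no-common-prime (⇔-trans (noCommonPrime-n⇔ x)
      (⇔-refl ×-⇔ ¬-cong-⇔ (≡⇒⇔ (_∣ x) (sym (*-identityʳ pₐ)))))))

  count-¬otherPrime∣∩pₐ^∣ : ∀ t → count (∁? otherPrime∣? ∩? (pₐ ^ t ∣?_)) (M t) ≡ φ m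
  count-¬otherPrime∣∩pₐ^∣ t = begin
    count (∁? otherPrime∣? ∩? (pₐ ^ t ∣?_)) (pₐ ^ t * m)
      ≡⟨ count-multiples (pₐ ^ t) m (∁? otherPrime∣?) {{pₐ^≢0 t}} ⟩
    count (λ y → ∁? otherPrime∣? (pₐ ^ t * y)) m
      ≡⟨ count-cong m _ _ (λ y → ¬-cong-⇔ (otherPrime∣-pₐ^* t y)) ⟩
    count (∁? otherPrime∣?) m
      ≡⟨ sym φm≡count ⟩
    φ m ∎
    where open ≡-Reasoning

  X+φm : ∀ t → X t + φ m ≡ pₐ ^ t * φ m
  X+φm t = begin
    X t + φ m
      ≡⟨ +-comm (X t) (φ m) ⟩
    φ m + X t
      ≡⟨ cong₂ _+_ (sym (trans (count-∩-comm (M t) (pₐ ^ t ∣?_) (∁? otherPrime∣?)) (count-¬otherPrime∣∩pₐ^∣ t)))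
                   (count-∩-comm (M t) (∁? otherPrime∣?) (∁? (pₐ ^ t ∣?_))) ⟩
    count ((pₐ ^ t ∣?_) ∩? ∁? otherPrime∣?) (M t) + count (∁? (pₐ ^ t ∣?_) ∩? ∁? otherPrime∣?) (M t)
      ≡⟨ count-partition (M t) (pₐ ^ t ∣?_) (∁? otherPrime∣?) ⟩
    count (∁? otherPrime∣?) (pₐ ^ t * m)
      ≡⟨ count-periodic m (pₐ ^ t) (∁? otherPrime∣?) (λ x → ¬-cong-⇔ (otherPrime∣-+ ∣-refl x)) ⟩
    pₐ ^ t * count (∁? otherPrime∣?) m
      ≡⟨ cong (pₐ ^ t *_) (sym φm≡count) ⟩
    pₐ ^ t * φ m ∎
    where open ≡-Reasoning

  Y+φm : ∀ t → Y t + φ m ≡ m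
  Y+φm t = begin
    Y t + φ m
      ≡⟨ cong (Y t +_) (sym (count-¬otherPrime∣∩pₐ^∣ t)) ⟩
    Y t + count (∁? otherPrime∣? ∩? (pₐ ^ t ∣?_)) (M t)
      ≡⟨ count-partition (M t) otherPrime∣? (pₐ ^ t ∣?_) ⟩
    count (pₐ ^ t ∣?_) (M t)
      ≡⟨ count-cong (M t) _ (U? ∩? (pₐ ^ t ∣?_)) (λ _ → mk⇔ (tt ,_) proj₂) ⟩
    count (U? ∩? (pₐ ^ t ∣?_)) (pₐ ^ t * m)
      ≡⟨ count-multiples (pₐ ^ t) m U? {{pₐ^≢0 t}} ⟩
    count (λ y → U? (pₐ ^ t * y)) m
      ≡⟨ count-U m ⟩
    m ∎
    where open ≡-Reasoning

  M≢0 : ∀ t → NonZero (M t)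
  M≢0 t = m*n≢0 (pₐ ^ t) m {{pₐ^≢0 t}}

  R : ℕ → ℕ
  R s = n ÷ M s

  n≡R*M : ∀ {s} → s ≤ e a → n ≡ R s * M s
  n≡R*M {s} s≤eₐ = ∣⇒≡÷* {{M≢0 s}} (subst (M s ∣_) (sym n≡pₐ^eₐ*D) (*-pres-∣ (^-mono-∣ pₐ s≤eₐ) m∣D))

  card-Z≡ : ∀ {s} → s ≤ e a → card-Z n r p a s ≡ R s * X s + R s * Y s
  card-Z≡ {s} s≤eₐ = begin
    card-Z n r p a s
      ≡⟨ length-filter-tabulate n (Z? n r p a s) id (inE? s ∪? inQ? s) (Z⇔InE⊎InQ s≤eₐ) ⟩
    count (inE? s ∪? inQ? s) n
      ≡⟨ count-∪ n (inE? s) (inQ? s) (λ _ (¬other , _) (other , _) → ¬other other) ⟩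
    count (inE? s) n + count (inQ? s) n
      ≡⟨ cong₂ (λ k l → count (inE? s) k + count (inQ? s) l) (n≡R*M s≤eₐ) (n≡R*M s≤eₐ) ⟩
    count (inE? s) (R s * M s) + count (inQ? s) (R s * M s)
      ≡⟨ cong₂ _+_ (count-X s (R s)) (count-Y s (R s)) ⟩
    R s * X s + R s * Y s ∎
    where open ≡-Reasoning

  φn≡ : ∀ {s} → suc s ≤ e a → φ n ≡ R (suc s) * pₐ ^ s * X 1
  φn≡ {s} 1+s≤eₐ = begin
    φ n                                         ≡⟨ φn≡count ⟩
    count (inE? 1) n                            ≡⟨ cong (count (inE? 1)) n≡ ⟩
    count (inE? 1) (R (suc s) * pₐ ^ s * M 1)   ≡⟨ count-X 1 (R (suc s) * pₐ ^ s) ⟩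
    R (suc s) * pₐ ^ s * X 1                    ∎
    where
    open ≡-Reasoning
    n≡ : n ≡ R (suc s) * pₐ ^ s * M 1
    n≡ = trans (n≡R*M {suc s} 1+s≤eₐ) (regroup (R (suc s)) pₐ (pₐ ^ s) m)
      where
      regroup : ∀ k q c l → k * (q * c * l) ≡ k * c * (q * 1 * l)
      regroup = solve-∀

  ∏p÷pₐ≡m : ∏ r p ÷ pₐ ≡ m
  ∏p÷pₐ≡m = trans (cong (_÷ pₐ) (trans (∏≡*∏-except a p) (*-comm pₐ m))) (÷-cancelʳ m pₐ)

  ∏p*pₐ^≡M : ∀ s → ∏ r p * pₐ ^ s ≡ M (suc s)
  ∏p*pₐ^≡M s = trans (cong (_* pₐ ^ s) (∏≡*∏-except a p)) (xy∙z≈xz∙y pₐ m (pₐ ^ s))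

open import Data.Integer using (+_; _+_; _-_) renaming (_*_ to _*ℤ_)
import Data.Nat as ℕ
open import Data.Nat using (suc; s≤s; z≤n)
open import Data.Nat.Properties using (<-cmp; <⇒≢)
open import Data.Fin.Properties using (toℕ-injective)
open import Relation.Binary.Definitions using (tri<; tri≈; tri>)
open import Relation.Nullary using (contradiction)
open import Relation.Binary.PropositionalEquality using (refl; sym; cong; cong₂; module ≡-Reasoning)
open IntegerArithmetic using (card-identity)

increasing⇒injective : ∀ {r} {f : Fin r → ℕ} → (∀ i j → toℕ i < toℕ j → f i < f j) →
                       ∀ {i j} → f i ≡ f j → i ≡ j
increasing⇒injective increasing {i} {j} fi≡fj with <-cmp (toℕ i) (toℕ j)
... | tri< i<j _ _ = contradiction fi≡fj (<⇒≢ (increasing i j i<j))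
... | tri≈ _ i≡j _ = toℕ-injective i≡j
... | tri> _ _ j<i = contradiction (sym fi≡fj) (<⇒≢ (increasing j i j<i))

proposition3p3 : (r : ℕ) → 2 ≤ r → (p e : Fin r → ℕ) →
    ((i : Fin r) → Prime (p i)) →
    ((i j : Fin r) → toℕ i < toℕ j → p i < p j) →
    ((i : Fin r) → 1 ≤ e i) →
    (n : ℕ) → n ≡ ∏ r (λ i → p i ^ e i) →
    (a : Fin r) (s : ℕ) → 1 ≤ s → s ≤ e a →
    + card-Z n r p a s
      ≡ + φ n
        + (+ (n ÷ (∏ r p * p a ^ (s ∸ 1))))
          *ℤ (+ (∏ r p ÷ p a) + (+ φ (∏ r p ÷ p a)) *ℤ (+ (p a ^ (s ∸ 1)) - + 2))
proposition3p3 r _ p e p-prime increasing e≥1 n refl a (suc s) (s≤s z≤n) 1+s≤eₐ = begin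
  + card-Z n r p a (suc s)
    ≡⟨ cong +_ (card-Z≡ 1+s≤eₐ) ⟩
  + (R (suc s) * X (suc s) ℕ.+ R (suc s) * Y (suc s))
    ≡⟨ card-identity {R (suc s)} {pₐ ^ s} {pₐ} (X+φm (suc s)) (Y+φm (suc s)) (X+φm 1) ⟩
  + (R (suc s) * pₐ ^ s * X 1) + + R (suc s) *ℤ (+ m + + φ m *ℤ (+ pₐ ^ s - + 2))
    ≡⟨ cong₂ (λ x k → + x + + k *ℤ (+ m + + φ m *ℤ (+ pₐ ^ s - + 2)))
             (sym (φn≡ 1+s≤eₐ)) (cong (n ÷_) (sym (∏p*pₐ^≡M s))) ⟩
  + φ n + + (n ÷ (∏ r p * pₐ ^ s)) *ℤ (+ m + + φ m *ℤ (+ pₐ ^ s - + 2))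
    ≡⟨ cong (λ k → + φ n + + (n ÷ (∏ r p * pₐ ^ s)) *ℤ (+ k + + φ k *ℤ (+ pₐ ^ s - + 2))) (sym ∏p÷pₐ≡m) ⟩
  + φ n + + (n ÷ (∏ r p * pₐ ^ s)) *ℤ (+ (∏ r p ÷ pₐ) + + φ (∏ r p ÷ pₐ) *ℤ (+ pₐ ^ s - + 2)) ∎
  where
  open ≡-Reasoning
  open Factored r p e p-prime (increasing⇒injective increasing) e≥1 a hiding (n)
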